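{- For every integer $m\ge1$, $\mathrm{p}_{231,132}(2m)=2^{m-1}$, and for every integer $m\ge0$, $\mathrm{p}_{231,132}(2m+1)=2^{m}$.
   Context: A parity-alternating permutation (PAP) of $[n]$ is a permutation $\pi$ with $\pi(i)\equiv i\pmod 2$ for all $i$. A permutation contains a pattern $\sigma$ if some subsequence of its one-line notation is order-isomorphic to $\sigma$, and avoids it otherwise. $\mathrm{p}_{\sigma,\tau}(n)$ is the number of PAPs of $[n]$ avoiding both $\sigma$ and $\tau$. -}

module Defs where

open import Data.Nat using (ℕ; zero; suc; _+_; _*_; _^_; _∸_; _%_)
open import Data.Fin using (Fin; toℕ; _<_; _≟_; _<?_)
open import Data.Fin.Properties using (any?; all?)
open import Data.Vec using (Vec; []; _∷_; lookup)
open import Data.List using (List; []; _∷_; length; filter; concatMap; map; allFin)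
open import Data.Product using (Σ; _×_; _,_; ∃)
open import Relation.Nullary using (¬_; Dec; yes; no)
open import Relation.Nullary.Decidable using (_×-dec_; ¬?; _→-dec_)
open import Relation.Binary.PropositionalEquality using (_≡_)
import Data.Nat.Properties as ℕP

-- A word of length n over [n] (0-based), in one-line notation: w(i) = lookup w i.
-- all words of length k over Fin n
words : (n k : ℕ) → List (Vec (Fin n) k)
words n zero = [] ∷ []
words n (suc k) = concatMap (λ x → map (x ∷_) (words n k)) (allFin n)

IsPerm : ∀ {n} → Vec (Fin n) n → Set
IsPerm {n} w = ∀ (i j : Fin n) → lookup w i ≡ lookup w j → i ≡ j

isPerm? : ∀ {n} (w : Vec (Fin n) n) → Dec (IsPerm w)
isPerm? w = all? λ i → all? λ j → (lookup w i ≟ lookup w j) →-dec (i ≟ j)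

-- parity-alternating: π(i) ≡ i (mod 2). With 0-based values and positions,
-- (π(i)+1) ≡ (i+1) mod 2 iff π(i) ≡ i mod 2.
IsPAP : ∀ {n} → Vec (Fin n) n → Set
IsPAP {n} w = ∀ (i : Fin n) → toℕ (lookup w i) % 2 ≡ toℕ i % 2

isPAP? : ∀ {n} (w : Vec (Fin n) n) → Dec (IsPAP w)
isPAP? w = all? λ i → toℕ (lookup w i) % 2 ℕP.≟ toℕ i % 2

OrderIso : ∀ {n k} → Vec (Fin n) k → Vec (Fin k) k → Set
OrderIso {k = k} u σ = ∀ (a b : Fin k) →
  (lookup u a < lookup u b → lookup σ a < lookup σ b) ×
  (lookup σ a < lookup σ b → lookup u a < lookup u b)

orderIso? : ∀ {n k} (u : Vec (Fin n) k) (σ : Vec (Fin k) k) → Dec (OrderIso u σ)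
orderIso? u σ = all? λ a → all? λ b →
  ((lookup u a <? lookup u b) →-dec (lookup σ a <? lookup σ b)) ×-dec
  ((lookup σ a <? lookup σ b) →-dec (lookup u a <? lookup u b))

Contains3 : ∀ {n} → Vec (Fin n) n → Vec (Fin 3) 3 → Set
Contains3 {n} w σ = ∃ λ (i : Fin n) → ∃ λ (j : Fin n) → ∃ λ (l : Fin n) →
  i < j × j < l × OrderIso (lookup w i ∷ lookup w j ∷ lookup w l ∷ []) σ

contains3? : ∀ {n} (w : Vec (Fin n) n) (σ : Vec (Fin 3) 3) → Dec (Contains3 w σ)
contains3? w σ = any? λ i → any? λ j → any? λ l →
  (i <? j) ×-dec ((j <? l) ×-dec orderIso? (lookup w i ∷ lookup w j ∷ lookup w l ∷ []) σ)

open import Data.Fin using (zero; suc)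

p231 : Vec (Fin 3) 3
p231 = suc zero ∷ suc (suc zero) ∷ zero ∷ []

p132 : Vec (Fin 3) 3
p132 = zero ∷ suc (suc zero) ∷ suc zero ∷ []

Avoiding : ∀ {n} → Vec (Fin 3) 3 → Vec (Fin 3) 3 → Vec (Fin n) n → Set
Avoiding σ τ w = IsPerm w × IsPAP w × ¬ Contains3 w σ × ¬ Contains3 w τ

avoiding? : ∀ {n} (σ τ : Vec (Fin 3) 3) (w : Vec (Fin n) n) → Dec (Avoiding σ τ w)
avoiding? σ τ w = isPerm? w ×-dec (isPAP? w ×-dec (¬? (contains3? w σ) ×-dec ¬? (contains3? w τ)))

pCount : Vec (Fin 3) 3 → Vec (Fin 3) 3 → ℕ → ℕ
pCount σ τ n = length (filter (avoiding? σ τ) (words n n))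

-- In a permutation avoiding both 231 and 132 the largest entry stands first or last: otherwise
-- the first and last entries together with the maximum form a 132 or a 231. Deleting it leaves
-- a {231,132}-avoiding permutation, and conversely the maximum may be put back at either end.
-- Parity alternation is tracked with an offset b (the entry at position p has the parity of
-- p + b), because deleting the first entry shifts every position. With 0-based values, the
-- number c_b(n) of such permutations of length n satisfies
--   c_b(n+2) = [n+1 fits at position n+1] c_b(n+1) + [n+1 fits at position 0] c_{not b}(n+1),
-- so c₀(2j+2) = c₀(2j+1) = c₁(2j+2) and c₀(2j+3) = c₀(2j+2) + c₁(2j+2) = 2 c₀(2j+1), c₀(1) = 1.

module Submission where

open import Defs
open import Data.Bool using (Bool; true; false; not; if_then_else_)
open import Data.Empty using (⊥-elim)
open import Data.Fin using (Fin; zero; suc; toℕ; fromℕ; inject₁; lower₁; _<_)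
import Data.Fin.Properties as Fin
open import Data.List using (List; []; _∷_; length; filter; _++_; allFin; concatMap; cartesianProductWith)
import Data.List as List
open import Data.List.Properties using (length-++; length-map; filter-all; filter-none)
open import Data.List.Membership.Propositional using (_∈_)
open import Data.List.Membership.Propositional.Properties
  using ( ∈-filter⁺; ∈-filter⁻; ∈-map⁺; ∈-map⁻; ∈-++⁺ˡ; ∈-++⁺ʳ; ∈-++⁻; ∈-allFin
        ; ∈-cartesianProductWith⁺)
open import Data.List.Membership.Propositional.Properties.WithK using (unique∧set⇒bag)
open import Data.List.Relation.Binary.BagAndSetEquality using (∼bag⇒↭)
open import Data.List.Relation.Binary.Permutation.Propositional.Properties using (↭-length)
open import Data.List.Relation.Binary.Disjoint.Propositional using (Disjoint)
open import Data.List.Relation.Unary.All using (All; [])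
open import Data.List.Relation.Unary.Any using (here)
open import Data.List.Relation.Unary.AllPairs using ([]; _∷_)
import Data.List.Relation.Unary.All as All
open import Data.List.Relation.Unary.All.Properties using (map⁺)
open import Data.List.Relation.Unary.Unique.Propositional using (Unique)
import Data.List.Relation.Unary.Unique.Propositional.Properties as Unique
open import Data.Nat using (ℕ; zero; suc; _+_; _*_; _^_; _∸_; _≥_; _%_; z<s; s<s)
  renaming (_<_ to _<ℕ_; _≤_ to _≤ℕ_)
import Data.Nat.Properties as ℕ
open import Data.Nat.DivMod using (m*n%n≡0; [m+kn]%n≡m%n)
open import Data.Product using (∃-syntax; _×_; _,_; proj₁; proj₂)
open import Data.Sum using (_⊎_; inj₁; inj₂; [_,_]′)
open import Data.Vec using (Vec; []; _∷_; lookup; _∷ʳ_; initLast)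
import Data.Vec as Vec
import Data.Vec.Properties as Vec
open import Data.Vec.Functional using (Vector; head; tail; init; last)
open import Function using (_∘_; _⇔_; mk⇔)
open import Relation.Binary.Definitions using (tri<; tri≈; tri>)
open import Relation.Binary.PropositionalEquality
open import Relation.Nullary using (¬_; Dec; yes; no; does)
open import Relation.Nullary.Decidable using (_×-dec_; ¬?; dec-true; dec-false)
open import Relation.Unary using (Decidable; ∁)

private
  variable
    b : Bool
    m n k : ℕ

-- Pattern occurrences in sequences of naturals

record Occurs (R : ℕ → ℕ → ℕ → Set) (f : Vector ℕ n) : Set where
  constructor occurrence
  field
    {i j l} : Fin n
    i<j     : i < j
    j<l     : j < l
    shape   : R (f i) (f j) (f l)

Is231 Is132 : ℕ → ℕ → ℕ → Set
Is231 x y z = z <ℕ x × x <ℕ y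
Is132 x y z = x <ℕ z × z <ℕ y

-- In both patterns the middle entry is the largest, so a strict maximum at either end of a
-- sequence takes part in no occurrence.
PeakInMiddle : (ℕ → ℕ → ℕ → Set) → Set
PeakInMiddle R = ∀ {x y z} → R x y z → x <ℕ y × z <ℕ y

is231-peak : PeakInMiddle Is231
is231-peak (z<x , x<y) = x<y , ℕ.<-trans z<x x<y

is132-peak : PeakInMiddle Is132
is132-peak (x<z , z<y) = ℕ.<-trans x<z z<y , z<y

fromℕ⊎inject₁ : (i : Fin (suc n)) → i ≡ fromℕ n ⊎ ∃[ j ] i ≡ inject₁ j
fromℕ⊎inject₁ {n} i with n ℕ.≟ toℕ i
... | yes n≡i = inj₁ (Fin.toℕ-injective (trans (sym n≡i) (sym (Fin.toℕ-fromℕ n))))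
... | no n≢i  = inj₂ (lower₁ i n≢i , sym (Fin.inject₁-lower₁ i n≢i))

<⇒inject₁ : {i j : Fin (suc n)} → i < j → ∃[ i′ ] i ≡ inject₁ i′
<⇒inject₁ {n} {i} {j} i<j = lower₁ i n≢i , sym (Fin.inject₁-lower₁ i n≢i)
  where
  n≢i : n ≢ toℕ i
  n≢i n≡i = ℕ.<-irrefl (sym n≡i) (ℕ.<-≤-trans i<j (Fin.toℕ≤pred[n] j))

inject₁-mono-< : {i j : Fin n} → i < j → inject₁ i < inject₁ j
inject₁-mono-< {i = i} {j} = subst₂ _<ℕ_ (sym (Fin.toℕ-inject₁ i)) (sym (Fin.toℕ-inject₁ j))

inject₁-cancel-< : {i j : Fin n} → inject₁ i < inject₁ j → i < j
inject₁-cancel-< {i = i} {j} = subst₂ _<ℕ_ (Fin.toℕ-inject₁ i) (Fin.toℕ-inject₁ j)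

inject₁<fromℕ : (i : Fin n) → inject₁ i < fromℕ n
inject₁<fromℕ {n} i = subst (toℕ (inject₁ i) <ℕ_) (sym (Fin.toℕ-fromℕ n)) (Fin.inject₁ℕ< i)

occurs-resp : ∀ {R} {f g : Vector ℕ n} → f ≗ g → Occurs R f → Occurs R g
occurs-resp {R = R} f≗g (occurrence {i} {j} {l} i<j j<l r) =
  occurrence i<j j<l (subst₂ (λ x y → R x y _) (f≗g i) (f≗g j) (subst (R _ _) (f≗g l) r))

occurs-∘ : ∀ {R} (f : Vector ℕ n) {g : Fin m → Fin n} → (∀ {i j} → i < j → g i < g j) →
           Occurs R (f ∘ g) → Occurs R f
occurs-∘ f mono (occurrence i<j j<l r) = occurrence (mono i<j) (mono j<l) r

occurs-tail : ∀ {R} (f : Vector ℕ (suc n)) → PeakInMiddle R → (∀ i → tail f i <ℕ head f) →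
              Occurs R f → Occurs R (tail f)
occurs-tail f peak top (occurrence {zero} {suc j} _ _ r) = ⊥-elim (ℕ.<-asym (proj₁ (peak r)) (top j))
occurs-tail f peak top (occurrence {suc _} {suc _} {suc _} (s<s i<j) (s<s j<l) r) = occurrence i<j j<l r

occurs-init : ∀ {R} (f : Vector ℕ (suc n)) → PeakInMiddle R → (∀ i → init f i <ℕ last f) →
              Occurs R f → Occurs R (init f)
occurs-init f peak top (occurrence {i} {j} {l} i<j j<l r)
  with <⇒inject₁ i<j | <⇒inject₁ j<l | fromℕ⊎inject₁ l
... | _ , refl | j , refl | inj₁ refl       = ⊥-elim (ℕ.<-asym (proj₂ (peak r)) (top j))
... | i , refl | j , refl | inj₂ (l , refl) = occurrence (inject₁-cancel-< i<j) (inject₁-cancel-< j<l) r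

max-at-end : (f : Vector ℕ (suc (suc n))) → ¬ Occurs Is231 f → ¬ Occurs Is132 f → head f ≢ last f →
             ∀ p → (∀ i → i ≢ p → f i <ℕ f p) → p ≡ zero ⊎ p ≡ fromℕ (suc n)
max-at-end f no231 no132 head≢last p top with fromℕ⊎inject₁ p
... | inj₁ p≡last = inj₂ p≡last
... | inj₂ (zero , refl) = inj₁ refl
... | inj₂ (suc q , refl) with ℕ.<-cmp (head f) (last f)
...   | tri< h<l _ _ =
  ⊥-elim (no132 (occurrence {i = zero} z<s (inject₁<fromℕ (suc q))
                             (h<l , top (fromℕ _) Fin.fromℕ≢inject₁)))
...   | tri≈ _ h≡l _ = ⊥-elim (head≢last h≡l)
...   | tri> _ _ l<h =
  ⊥-elim (no231 (occurrence {i = zero} z<s (inject₁<fromℕ (suc q))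
                             (l<h , top zero λ ())))

-- Parity-alternating avoiders with a parity offset

bit : Bool → ℕ
bit false = 0
bit true  = 1

-- Offset b allows value v at 0-based position p iff v ≡ p + b (mod 2); offset false is the
-- parity-alternating condition, and deleting the first entry flips the offset.
Fits : Bool → ℕ → ℕ → Set
Fits b v p = v % 2 ≡ (bit b + p) % 2

fits? : ∀ b v p → Dec (Fits b v p)
fits? b v p = v % 2 ℕ.≟ (bit b + p) % 2

Alternating : Bool → Vector ℕ n → Set
Alternating b f = ∀ i → Fits b (f i) (toℕ i)

record IsAvoidingPAP (b : Bool) (f : Vector ℕ n) : Set where
  field
    injective   : ∀ i j → f i ≡ f j → i ≡ j
    alternating : Alternating b f
    avoids231   : ¬ Occurs Is231 f
    avoids132   : ¬ Occurs Is132 f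

open IsAvoidingPAP

IsAvoidingPAP-resp : {f g : Vector ℕ n} → f ≗ g → IsAvoidingPAP b f → IsAvoidingPAP b g
IsAvoidingPAP-resp {b = b} f≗g a = record
  { injective   = λ i j eq → injective a i j (trans (f≗g i) (trans eq (sym (f≗g j))))
  ; alternating = λ i → subst (λ v → Fits b v (toℕ i)) (f≗g i) (alternating a i)
  ; avoids231   = λ occ → avoids231 a (occurs-resp (sym ∘ f≗g) occ)
  ; avoids132   = λ occ → avoids132 a (occurs-resp (sym ∘ f≗g) occ)
  }

IsAvoidingPAP-tail : (f : Vector ℕ (suc n)) → IsAvoidingPAP b f → IsAvoidingPAP (not b) (tail f)
IsAvoidingPAP-tail {b = b} f a = record
  { injective   = λ i j eq → Fin.suc-injective (injective a (suc i) (suc j) eq)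
  ; alternating = shift b (alternating a)
  ; avoids231   = λ occ → avoids231 a (occurs-∘ f s<s occ)
  ; avoids132   = λ occ → avoids132 a (occurs-∘ f s<s occ)
  }
  where
  shift : ∀ b → Alternating b f → Alternating (not b) (tail f)
  shift false alt i = alt (suc i)
  shift true  alt i = alt (suc i)

IsAvoidingPAP-init : (f : Vector ℕ (suc n)) → IsAvoidingPAP b f → IsAvoidingPAP b (init f)
IsAvoidingPAP-init {b = b} f a = record
  { injective   = λ i j eq → Fin.inject₁-injective (injective a (inject₁ i) (inject₁ j) eq)
  ; alternating = λ i → subst (Fits b (init f i)) (Fin.toℕ-inject₁ i) (alternating a (inject₁ i))
  ; avoids231   = λ occ → avoids231 a (occurs-∘ f inject₁-mono-< occ)
  ; avoids132   = λ occ → avoids132 a (occurs-∘ f inject₁-mono-< occ)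
  }

IsAvoidingPAP-cons : (f : Vector ℕ (suc n)) → (∀ i → tail f i <ℕ head f) → Fits b (head f) 0 →
                     IsAvoidingPAP (not b) (tail f) → IsAvoidingPAP b f
IsAvoidingPAP-cons {b = b} f top head-fits a = record
  { injective   = inj
  ; alternating = unshift b head-fits (alternating a)
  ; avoids231   = λ occ → avoids231 a (occurs-tail f is231-peak top occ)
  ; avoids132   = λ occ → avoids132 a (occurs-tail f is132-peak top occ)
  }
  where
  inj : ∀ i j → f i ≡ f j → i ≡ j
  inj zero    zero    _  = refl
  inj zero    (suc j) eq = ⊥-elim (ℕ.<-irrefl (sym eq) (top j))
  inj (suc i) zero    eq = ⊥-elim (ℕ.<-irrefl eq (top i))
  inj (suc i) (suc j) eq = cong suc (injective a i j eq)
  unshift : ∀ b → Fits b (head f) 0 → Alternating (not b) (tail f) → Alternating b f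
  unshift false h _   zero    = h
  unshift false _ alt (suc i) = alt i
  unshift true  h _   zero    = h
  unshift true  _ alt (suc i) = alt i

IsAvoidingPAP-snoc : (f : Vector ℕ (suc n)) → (∀ i → init f i <ℕ last f) → Fits b (last f) n →
                     IsAvoidingPAP b (init f) → IsAvoidingPAP b f
IsAvoidingPAP-snoc {n} {b} f top last-fits a = record
  { injective   = inj
  ; alternating = alt
  ; avoids231   = λ occ → avoids231 a (occurs-init f is231-peak top occ)
  ; avoids132   = λ occ → avoids132 a (occurs-init f is132-peak top occ)
  }
  where
  inj : ∀ i j → f i ≡ f j → i ≡ j
  inj i j eq with fromℕ⊎inject₁ i | fromℕ⊎inject₁ j
  ... | inj₁ refl       | inj₁ refl       = refl
  ... | inj₁ refl       | inj₂ (j , refl) = ⊥-elim (ℕ.<-irrefl (sym eq) (top j))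
  ... | inj₂ (i , refl) | inj₁ refl       = ⊥-elim (ℕ.<-irrefl eq (top i))
  ... | inj₂ (i , refl) | inj₂ (j , refl) = cong inject₁ (injective a i j eq)
  alt : Alternating b f
  alt i with fromℕ⊎inject₁ i
  ... | inj₁ refl       = subst (Fits b (last f)) (sym (Fin.toℕ-fromℕ n)) last-fits
  ... | inj₂ (i , refl) = subst (Fits b (init f i)) (sym (Fin.toℕ-inject₁ i)) (alternating a i)

values : Vec (Fin m) n → Vector ℕ n
values w i = toℕ (lookup w i)

AvoidingPAP : Bool → Vec (Fin n) n → Set
AvoidingPAP b w = IsPerm w × Alternating b (values w) × ¬ Contains3 w p231 × ¬ Contains3 w p132

-- For b = false this is definitionally avoiding? p231 p132 from Defs.
avoidingPAP? : ∀ b (w : Vec (Fin n) n) → Dec (AvoidingPAP b w)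
avoidingPAP? b w = isPerm? w ×-dec (Fin.all? (λ i → fits? b (values w i) (toℕ i))
                   ×-dec (¬? (contains3? w p231) ×-dec ¬? (contains3? w p132)))

orderIso-by-ranks : (u : Vec (Fin m) k) (σ : Vec (Fin k) k) (rank : Fin k → ℕ) →
                    (∀ {i j} → i < j → rank i <ℕ rank j) → (∀ a → values u a ≡ rank (lookup σ a)) →
                    OrderIso u σ
orderIso-by-ranks u σ rank mono u≡rank a b = reflect , preserve
  where
  preserve : lookup σ a < lookup σ b → lookup u a < lookup u b
  preserve σa<σb = subst₂ _<ℕ_ (sym (u≡rank a)) (sym (u≡rank b)) (mono σa<σb)
  reflect : lookup u a < lookup u b → lookup σ a < lookup σ b
  reflect ua<ub with Fin.<-cmp (lookup σ a) (lookup σ b)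
  ... | tri< σa<σb _ _ = σa<σb
  ... | tri≈ _ σa≡σb _ =
    ⊥-elim (ℕ.<-irrefl (trans (u≡rank a) (trans (cong rank σa≡σb) (sym (u≡rank b)))) ua<ub)
  ... | tri> _ _ σb<σa =
    ⊥-elim (ℕ.<-asym ua<ub (subst₂ _<ℕ_ (sym (u≡rank b)) (sym (u≡rank a)) (mono σb<σa)))

increasing₃ : (g : Fin 3 → ℕ) → g zero <ℕ g (suc zero) → g (suc zero) <ℕ g (suc (suc zero)) →
              ∀ {i j} → i < j → g i <ℕ g j
increasing₃ g g₀<g₁ g₁<g₂ {zero}     {suc zero}       _ = g₀<g₁
increasing₃ g g₀<g₁ g₁<g₂ {zero}     {suc (suc zero)} _ = ℕ.<-trans g₀<g₁ g₁<g₂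
increasing₃ g g₀<g₁ g₁<g₂ {suc zero} {suc (suc zero)} _ = g₁<g₂
increasing₃ g g₀<g₁ g₁<g₂ {suc zero} {suc zero} (s<s ())
increasing₃ g g₀<g₁ g₁<g₂ {suc (suc zero)} {suc (suc zero)} (s<s (s<s ()))

contains231⇒occurs : (w : Vec (Fin n) n) → Contains3 w p231 → Occurs Is231 (values w)
contains231⇒occurs w (i , j , l , i<j , j<l , iso) =
  occurrence i<j j<l (proj₂ (iso (suc (suc zero)) zero) z<s , proj₂ (iso zero (suc zero)) (s<s z<s))

contains132⇒occurs : (w : Vec (Fin n) n) → Contains3 w p132 → Occurs Is132 (values w)
contains132⇒occurs w (i , j , l , i<j , j<l , iso) =
  occurrence i<j j<l
    (proj₂ (iso zero (suc (suc zero))) z<s , proj₂ (iso (suc (suc zero)) (suc zero)) (s<s z<s))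

occurs231⇒contains : (w : Vec (Fin n) n) → Occurs Is231 (values w) → Contains3 w p231
occurs231⇒contains w (occurrence {i} {j} {l} i<j j<l (z<x , x<y)) =
  i , j , l , i<j , j<l ,
  orderIso-by-ranks (lookup w i ∷ lookup w j ∷ lookup w l ∷ []) p231 rank (increasing₃ rank z<x x<y)
    λ where zero → refl ; (suc zero) → refl ; (suc (suc zero)) → refl
  where
  rank : Fin 3 → ℕ
  rank zero             = values w l
  rank (suc zero)       = values w i
  rank (suc (suc zero)) = values w j

occurs132⇒contains : (w : Vec (Fin n) n) → Occurs Is132 (values w) → Contains3 w p132
occurs132⇒contains w (occurrence {i} {j} {l} i<j j<l (x<z , z<y)) =
  i , j , l , i<j , j<l ,
  orderIso-by-ranks (lookup w i ∷ lookup w j ∷ lookup w l ∷ []) p132 rank (increasing₃ rank x<z z<y)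
    λ where zero → refl ; (suc zero) → refl ; (suc (suc zero)) → refl
  where
  rank : Fin 3 → ℕ
  rank zero             = values w i
  rank (suc zero)       = values w l
  rank (suc (suc zero)) = values w j

AvoidingPAP⇒IsAvoidingPAP : ∀ b (w : Vec (Fin n) n) → AvoidingPAP b w → IsAvoidingPAP b (values w)
AvoidingPAP⇒IsAvoidingPAP b w (perm , alt , no231 , no132) = record
  { injective   = λ i j eq → perm i j (Fin.toℕ-injective eq)
  ; alternating = alt
  ; avoids231   = no231 ∘ occurs231⇒contains w
  ; avoids132   = no132 ∘ occurs132⇒contains w
  }

IsAvoidingPAP⇒AvoidingPAP : (w : Vec (Fin n) n) → IsAvoidingPAP b (values w) → AvoidingPAP b w
IsAvoidingPAP⇒AvoidingPAP w a =
  (λ i j eq → injective a i j (cong toℕ eq)) , alternating a ,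
  avoids231 a ∘ contains231⇒occurs w , avoids132 a ∘ contains132⇒occurs w

-- Removing the maximum

consMax : Vec (Fin m) k → Vec (Fin (suc m)) (suc k)
consMax {m} u = fromℕ m ∷ Vec.map inject₁ u

snocMax : Vec (Fin m) k → Vec (Fin (suc m)) (suc k)
snocMax {m} u = Vec.map inject₁ u ∷ʳ fromℕ m

lookup-∷ʳ-last : ∀ {A : Set} (xs : Vec A n) x → lookup (xs ∷ʳ x) (fromℕ n) ≡ x
lookup-∷ʳ-last []       x = refl
lookup-∷ʳ-last (_ ∷ xs) x = lookup-∷ʳ-last xs x

lookup-∷ʳ-inject₁ : ∀ {A : Set} (xs : Vec A n) x i → lookup (xs ∷ʳ x) (inject₁ i) ≡ lookup xs i
lookup-∷ʳ-inject₁ (_ ∷ xs) x zero    = refl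
lookup-∷ʳ-inject₁ (_ ∷ xs) x (suc i) = lookup-∷ʳ-inject₁ xs x i

values-map-inject₁ : (u : Vec (Fin m) k) → values (Vec.map inject₁ u) ≗ values u
values-map-inject₁ u i = trans (cong toℕ (Vec.lookup-map i inject₁ u)) (Fin.toℕ-inject₁ (lookup u i))

values-snocMax-init : (u : Vec (Fin m) k) → init (values (snocMax u)) ≗ values u
values-snocMax-init u i =
  trans (cong toℕ (lookup-∷ʳ-inject₁ (Vec.map inject₁ u) _ i)) (values-map-inject₁ u i)

values-snocMax-last : (u : Vec (Fin m) k) → last (values (snocMax u)) ≡ m
values-snocMax-last {m} u = trans (cong toℕ (lookup-∷ʳ-last (Vec.map inject₁ u) _)) (Fin.toℕ-fromℕ m)

map-injective : ∀ {A B : Set} {f : A → B} → (∀ {x y} → f x ≡ f y → x ≡ y) →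
                {xs ys : Vec A n} → Vec.map f xs ≡ Vec.map f ys → xs ≡ ys
map-injective f-inj {[]}     {[]}     _  = refl
map-injective f-inj {x ∷ xs} {y ∷ ys} eq =
  cong₂ _∷_ (f-inj (Vec.∷-injectiveˡ eq)) (map-injective f-inj (Vec.∷-injectiveʳ eq))

consMax-injective : {u v : Vec (Fin m) k} → consMax u ≡ consMax v → u ≡ v
consMax-injective = map-injective Fin.inject₁-injective ∘ Vec.∷-injectiveʳ

snocMax-injective : {u v : Vec (Fin m) k} → snocMax u ≡ snocMax v → u ≡ v
snocMax-injective = map-injective Fin.inject₁-injective ∘ Vec.∷ʳ-injectiveˡ _ _

snocMax≢consMax : (u v : Vec (Fin m) (suc k)) → snocMax u ≢ consMax v
snocMax≢consMax (x ∷ _) _ eq = Fin.fromℕ≢inject₁ (sym (Vec.∷-injectiveˡ eq))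

map-inject₁-surjective : (t : Vec (Fin (suc m)) k) → (∀ i → values t i <ℕ m) →
                         ∃[ u ] Vec.map inject₁ u ≡ t
map-inject₁-surjective []      _     = [] , refl
map-inject₁-surjective {m} (x ∷ t) below with map-inject₁-surjective t (below ∘ suc)
... | u , refl = lower₁ x m≢x ∷ u , cong (_∷ Vec.map inject₁ u) (Fin.inject₁-lower₁ x m≢x)
  where
  m≢x : m ≢ toℕ x
  m≢x m≡x = ℕ.<-irrefl (sym m≡x) (below zero)

consMax-avoidingPAP : ∀ b (u : Vec (Fin m) m) → Fits b m 0 → AvoidingPAP (not b) u →
                      AvoidingPAP b (consMax u)
consMax-avoidingPAP {m} b u fits ok =
  IsAvoidingPAP⇒AvoidingPAP (consMax u) (IsAvoidingPAP-cons (values (consMax u)) top head-fits tail-ok)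
  where
  top : ∀ i → values (Vec.map inject₁ u) i <ℕ toℕ (fromℕ m)
  top i = subst₂ _<ℕ_ (sym (values-map-inject₁ u i)) (sym (Fin.toℕ-fromℕ m)) (Fin.toℕ<n (lookup u i))
  head-fits : Fits b (toℕ (fromℕ m)) 0
  head-fits = subst (λ v → Fits b v 0) (sym (Fin.toℕ-fromℕ m)) fits
  tail-ok : IsAvoidingPAP (not b) (values (Vec.map inject₁ u))
  tail-ok = IsAvoidingPAP-resp (sym ∘ values-map-inject₁ u) (AvoidingPAP⇒IsAvoidingPAP (not b) u ok)

consMax-avoidingPAP⁻ : ∀ b (u : Vec (Fin m) m) → AvoidingPAP b (consMax u) →
                       Fits b m 0 × AvoidingPAP (not b) u
consMax-avoidingPAP⁻ {m} b u ok =
  subst (λ v → Fits b v 0) (Fin.toℕ-fromℕ m) (alternating a zero) ,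
  IsAvoidingPAP⇒AvoidingPAP u (IsAvoidingPAP-resp (values-map-inject₁ u) (IsAvoidingPAP-tail _ a))
  where
  a : IsAvoidingPAP b (values (consMax u))
  a = AvoidingPAP⇒IsAvoidingPAP b (consMax u) ok

snocMax-avoidingPAP : ∀ b (u : Vec (Fin m) m) → Fits b m m → AvoidingPAP b u →
                      AvoidingPAP b (snocMax u)
snocMax-avoidingPAP {m} b u fits ok =
  IsAvoidingPAP⇒AvoidingPAP (snocMax u) (IsAvoidingPAP-snoc (values (snocMax u)) top last-fits init-ok)
  where
  top : ∀ i → init (values (snocMax u)) i <ℕ last (values (snocMax u))
  top i =
    subst₂ _<ℕ_ (sym (values-snocMax-init u i)) (sym (values-snocMax-last u)) (Fin.toℕ<n (lookup u i))
  last-fits : Fits b (last (values (snocMax u))) m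
  last-fits = subst (λ v → Fits b v m) (sym (values-snocMax-last u)) fits
  init-ok : IsAvoidingPAP b (init (values (snocMax u)))
  init-ok = IsAvoidingPAP-resp (sym ∘ values-snocMax-init u) (AvoidingPAP⇒IsAvoidingPAP b u ok)

snocMax-avoidingPAP⁻ : ∀ b (u : Vec (Fin m) m) → AvoidingPAP b (snocMax u) →
                       Fits b m m × AvoidingPAP b u
snocMax-avoidingPAP⁻ {m} b u ok =
  subst₂ (Fits b) (values-snocMax-last u) (Fin.toℕ-fromℕ m) (alternating a (fromℕ m)) ,
  IsAvoidingPAP⇒AvoidingPAP u (IsAvoidingPAP-resp (values-snocMax-init u) (IsAvoidingPAP-init _ a))
  where
  a : IsAvoidingPAP b (values (snocMax u))
  a = AvoidingPAP⇒IsAvoidingPAP b (snocMax u) ok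

consMax-view : (z : Vec (Fin (suc m)) (suc k)) → values z zero ≡ m → (∀ i → values z (suc i) <ℕ m) →
               ∃[ u ] z ≡ consMax u
consMax-view {m} (x ∷ t) x≡m below with map-inject₁-surjective t below
... | u , refl =
  u , cong (_∷ Vec.map inject₁ u) (Fin.toℕ-injective (trans x≡m (sym (Fin.toℕ-fromℕ m))))

snocMax-view : (z : Vec (Fin (suc m)) (suc k)) → values z (fromℕ k) ≡ m →
               (∀ i → values z (inject₁ i) <ℕ m) → ∃[ u ] z ≡ snocMax u
snocMax-view {m} z last≡m below with initLast z
... | ys , y , refl
  with map-inject₁-surjective ys
         (λ i → subst (_<ℕ m) (cong toℕ (lookup-∷ʳ-inject₁ ys y i)) (below i))
... | u , refl = u , cong (Vec.map inject₁ u ∷ʳ_) (Fin.toℕ-injective y≡max)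
  where
  y≡max : toℕ y ≡ toℕ (fromℕ m)
  y≡max = begin
    toℕ y                                          ≡⟨ cong toℕ (lookup-∷ʳ-last (Vec.map inject₁ u) y) ⟨
    toℕ (lookup (Vec.map inject₁ u ∷ʳ y) (fromℕ _)) ≡⟨ last≡m ⟩
    m                                              ≡⟨ Fin.toℕ-fromℕ m ⟨
    toℕ (fromℕ m)                                  ∎
    where open ≡-Reasoning

max-position : (z : Vec (Fin (suc m)) (suc m)) → IsPerm z → ∃[ p ] values z p ≡ m
max-position {m} z perm with Fin.injective⇒existsPivot (λ {i} {j} → perm i j) (fromℕ m)
... | p , _ , m≤zp =
  p , ℕ.≤-antisym (Fin.toℕ≤pred[n] (lookup z p))
                  (subst (_≤ℕ toℕ (lookup z p)) (Fin.toℕ-fromℕ m) m≤zp)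

others<max : (z : Vec (Fin (suc m)) (suc m)) → IsPerm z → ∀ {p} → values z p ≡ m →
            ∀ i → i ≢ p → values z i <ℕ m
others<max z perm {p} zp≡m i i≢p =
  ℕ.≤∧≢⇒< (Fin.toℕ≤pred[n] (lookup z i))
          λ zi≡m → i≢p (perm i p (Fin.toℕ-injective (trans zi≡m (sym zp≡m))))

avoiding⇒snocMax⊎consMax : (z : Vec (Fin (suc (suc n))) (suc (suc n))) → IsPerm z →
                           ¬ Contains3 z p231 → ¬ Contains3 z p132 →
                           (∃[ u ] z ≡ snocMax u) ⊎ (∃[ u ] z ≡ consMax u)
avoiding⇒snocMax⊎consMax {n} z perm no231 no132 with max-position z perm
... | p , zp≡max with max-at-end (values z) (no231 ∘ occurs231⇒contains z) (no132 ∘ occurs132⇒contains z)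
                                 head≢last p top
  where
  head≢last : values z zero ≢ values z (fromℕ (suc n))
  head≢last eq with perm zero (fromℕ (suc n)) (Fin.toℕ-injective eq)
  ... | ()
  top : ∀ i → i ≢ p → values z i <ℕ values z p
  top i i≢p = subst (values z i <ℕ_) (sym zp≡max) (others<max z perm zp≡max i i≢p)
... | inj₁ refl = inj₂ (consMax-view z zp≡max λ i → others<max z perm zp≡max (suc i) λ ())
... | inj₂ refl =
  inj₁ (snocMax-view z zp≡max λ i →
          others<max z perm zp≡max (inject₁ i) (Fin.fromℕ≢inject₁ ∘ sym))

-- Counting

concatMap-map≡cartesianProductWith : ∀ {A B C : Set} (f : A → B → C) (xs : List A) (ys : List B) →
                                     concatMap (λ x → List.map (f x) ys) xs ≡ cartesianProductWith f xs ys
concatMap-map≡cartesianProductWith f []       ys = refl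
concatMap-map≡cartesianProductWith f (x ∷ xs) ys =
  cong (List.map (f x) ys ++_) (concatMap-map≡cartesianProductWith f xs ys)

words-complete : ∀ n k (w : Vec (Fin n) k) → w ∈ words n k
words-complete n zero    []      = here refl
words-complete n (suc k) (x ∷ w) =
  subst (x ∷ w ∈_) (sym (concatMap-map≡cartesianProductWith _∷_ (allFin n) (words n k)))
        (∈-cartesianProductWith⁺ _∷_ (∈-allFin x) (words-complete n k w))

words-unique : ∀ n k → Unique (words n k)
words-unique n zero    = [] ∷ []
words-unique n (suc k) =
  subst Unique (sym (concatMap-map≡cartesianProductWith _∷_ (allFin n) (words n k)))
        (Unique.cartesianProductWith⁺ _∷_ Vec.∷-injective (Unique.allFin⁺ n) (words-unique n k))

unique∧set⇒length≡ : ∀ {A : Set} {xs ys : List A} → Unique xs → Unique ys →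
                      (∀ {z} → z ∈ xs ⇔ z ∈ ys) → length xs ≡ length ys
unique∧set⇒length≡ xs! ys! xs≈ys = ↭-length (∼bag⇒↭ (unique∧set⇒bag xs! ys! xs≈ys))

length-filter-map-if : ∀ {A B : Set} {Q : B → Set} (Q? : Decidable Q) (f : A → B) (xs : List A)
                       {P : Set} (P? : Dec P) → (P → All (Q ∘ f) xs) → (¬ P → All (∁ Q ∘ f) xs) →
                       length (filter Q? (List.map f xs)) ≡ (if does P? then length xs else 0)
length-filter-map-if Q? f xs (yes p) all _  =
  trans (cong length (filter-all Q? (map⁺ (all p)))) (length-map f xs)
length-filter-map-if Q? f xs (no ¬p) _ none = cong length (filter-none Q? (map⁺ (none ¬p)))

-- Opaque so that the exhaustive list words n n is never unfolded during type checking.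
opaque
  solutions : Bool → (n : ℕ) → List (Vec (Fin n) n)
  solutions b n = filter (avoidingPAP? b) (words n n)

count : Bool → ℕ → ℕ
count b n = length (solutions b n)

opaque
  unfolding solutions

  ∈-solutions⁺ : {w : Vec (Fin n) n} → AvoidingPAP b w → w ∈ solutions b n
  ∈-solutions⁺ {b = b} {w} = ∈-filter⁺ (avoidingPAP? b) (words-complete _ _ w)

  ∈-solutions⁻ : {w : Vec (Fin n) n} → w ∈ solutions b n → AvoidingPAP b w
  ∈-solutions⁻ {n} {b} w∈ = proj₂ (∈-filter⁻ (avoidingPAP? b) {xs = words n n} w∈)

  solutions-unique : Unique (solutions b n)
  solutions-unique {b} {n} = Unique.filter⁺ (avoidingPAP? b) (words-unique n n)

  pCount≡count : ∀ n → pCount p231 p132 n ≡ count false n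
  pCount≡count n = refl

  count-false-1 : count false 1 ≡ 1
  count-false-1 = refl

module _ (b : Bool) (n : ℕ) where

  private
    Word : Set
    Word = Vec (Fin (suc (suc n))) (suc (suc n))

    -- The filter discards the extensions whose new maximum has the wrong parity: all of them
    -- or none, see length-extensionsʳ and length-extensionsˡ.
    extensions : Bool → (Vec (Fin (suc n)) (suc n) → Word) → List Word
    extensions c g = filter (avoidingPAP? b) (List.map g (solutions c (suc n)))

    extensionsʳ extensionsˡ : List Word
    extensionsʳ = extensions b snocMax
    extensionsˡ = extensions (not b) consMax

    ∈-extensions⁻ : ∀ c g {z} → z ∈ extensions c g → ∃[ u ] u ∈ solutions c (suc n) × z ≡ g u
    ∈-extensions⁻ c g z∈ =
      ∈-map⁻ g (proj₁ (∈-filter⁻ (avoidingPAP? b) {xs = List.map g (solutions c (suc n))} z∈))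

    extensions-avoidingPAP : ∀ {c g z} → z ∈ extensions c g → AvoidingPAP b z
    extensions-avoidingPAP {c} {g} z∈ =
      proj₂ (∈-filter⁻ (avoidingPAP? b) {xs = List.map g (solutions c (suc n))} z∈)

    extensions-unique : ∀ {c g} → (∀ {u v} → g u ≡ g v → u ≡ v) → Unique (extensions c g)
    extensions-unique g-inj = Unique.filter⁺ (avoidingPAP? b) (Unique.map⁺ g-inj solutions-unique)

    extensionsʳ⁺ : ∀ u → AvoidingPAP b (snocMax u) → snocMax u ∈ extensionsʳ
    extensionsʳ⁺ u ok =
      ∈-filter⁺ (avoidingPAP? b)
        (∈-map⁺ snocMax (∈-solutions⁺ (proj₂ (snocMax-avoidingPAP⁻ b u ok)))) ok

    extensionsˡ⁺ : ∀ u → AvoidingPAP b (consMax u) → consMax u ∈ extensionsˡ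
    extensionsˡ⁺ u ok =
      ∈-filter⁺ (avoidingPAP? b)
        (∈-map⁺ consMax (∈-solutions⁺ (proj₂ (consMax-avoidingPAP⁻ b u ok)))) ok

    solutions⊆extensions : ∀ {z} → z ∈ solutions b (suc (suc n)) → z ∈ extensionsʳ ++ extensionsˡ
    solutions⊆extensions {z} z∈ =
      [ (λ { (u , refl) → ∈-++⁺ˡ (extensionsʳ⁺ u ok) })
      , (λ { (u , refl) → ∈-++⁺ʳ extensionsʳ (extensionsˡ⁺ u ok) })
      ]′ (avoiding⇒snocMax⊎consMax z perm no231 no132)
      where
      ok : AvoidingPAP b z
      ok = ∈-solutions⁻ z∈
      perm : IsPerm z
      perm = proj₁ ok
      no231 : ¬ Contains3 z p231
      no231 = proj₁ (proj₂ (proj₂ ok))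
      no132 : ¬ Contains3 z p132
      no132 = proj₂ (proj₂ (proj₂ ok))

    extensions⊆solutions : ∀ {z} → z ∈ extensionsʳ ++ extensionsˡ → z ∈ solutions b (suc (suc n))
    extensions⊆solutions z∈ =
      ∈-solutions⁺ ([ extensions-avoidingPAP , extensions-avoidingPAP ]′ (∈-++⁻ extensionsʳ z∈))

    disjoint : Disjoint extensionsʳ extensionsˡ
    disjoint (z∈ʳ , z∈ˡ) =
      let u , _ , z≡snocMax = ∈-extensions⁻ b snocMax z∈ʳ
          v , _ , z≡consMax = ∈-extensions⁻ (not b) consMax z∈ˡ
      in snocMax≢consMax u v (trans (sym z≡snocMax) z≡consMax)

    length-extensionsʳ : length extensionsʳ ≡ (if does (fits? b (suc n) (suc n)) then count b (suc n) else 0)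
    length-extensionsʳ =
      length-filter-map-if (avoidingPAP? b) snocMax (solutions b (suc n)) (fits? b (suc n) (suc n))
        (λ fits → All.tabulate λ {u} u∈ → snocMax-avoidingPAP b u fits (∈-solutions⁻ u∈))
        (λ misfit → All.tabulate λ {u} _ ok → misfit (proj₁ (snocMax-avoidingPAP⁻ b u ok)))

    length-extensionsˡ : length extensionsˡ ≡ (if does (fits? b (suc n) 0) then count (not b) (suc n) else 0)
    length-extensionsˡ =
      length-filter-map-if (avoidingPAP? b) consMax (solutions (not b) (suc n)) (fits? b (suc n) 0)
        (λ fits → All.tabulate λ {u} u∈ → consMax-avoidingPAP b u fits (∈-solutions⁻ u∈))
        (λ misfit → All.tabulate λ {u} _ ok → misfit (proj₁ (consMax-avoidingPAP⁻ b u ok)))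

  count-step : count b (suc (suc n)) ≡
               (if does (fits? b (suc n) (suc n)) then count b (suc n) else 0) +
               (if does (fits? b (suc n) 0) then count (not b) (suc n) else 0)
  count-step = begin
    count b (suc (suc n))
      ≡⟨ unique∧set⇒length≡ solutions-unique
           (Unique.++⁺ (extensions-unique snocMax-injective) (extensions-unique consMax-injective) disjoint)
           (mk⇔ solutions⊆extensions extensions⊆solutions) ⟩
    length (extensionsʳ ++ extensionsˡ)
      ≡⟨ length-++ extensionsʳ ⟩
    length extensionsʳ + length extensionsˡ
      ≡⟨ cong₂ _+_ length-extensionsʳ length-extensionsˡ ⟩
    _ ∎
    where open ≡-Reasoning

[2j]%2≡0 : ∀ j → (2 * j) % 2 ≡ 0
[2j]%2≡0 j = trans (cong (_% 2) (ℕ.*-comm 2 j)) (m*n%n≡0 j 2)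

[1+2j]%2≡1 : ∀ j → (1 + 2 * j) % 2 ≡ 1
[1+2j]%2≡1 j = trans (cong (λ k → (1 + k) % 2) (ℕ.*-comm 2 j)) ([m+kn]%n≡m%n 1 j 2)

m%2≢[1+m]%2 : ∀ m → m % 2 ≢ (1 + m) % 2
m%2≢[1+m]%2 zero          ()
m%2≢[1+m]%2 (suc zero)    ()
m%2≢[1+m]%2 (suc (suc m)) = m%2≢[1+m]%2 m

if-yes : ∀ {P : Set} (P? : Dec P) {x y : ℕ} → P → (if does P? then x else y) ≡ x
if-yes P? p rewrite dec-true P? p = refl

if-no : ∀ {P : Set} (P? : Dec P) {x y : ℕ} → ¬ P → (if does P? then x else y) ≡ y
if-no P? ¬p rewrite dec-false P? ¬p = refl

count-even : ∀ j → count false (2 + 2 * j) ≡ count false (1 + 2 * j)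
count-even j = begin
  count false (2 + 2 * j)
    ≡⟨ count-step false (2 * j) ⟩
  (if does (fits? false odd odd) then count false odd else 0) +
  (if does (fits? false odd 0) then count true odd else 0)
    ≡⟨ cong₂ _+_ (if-yes (fits? false odd odd) refl) (if-no (fits? false odd 0) odd≢even) ⟩
  count false odd + 0
    ≡⟨ ℕ.+-identityʳ _ ⟩
  count false odd
    ∎
  where
  open ≡-Reasoning
  odd : ℕ
  odd = 1 + 2 * j
  odd≢even : ¬ Fits false odd 0
  odd≢even odd≡0 = ℕ.1+n≢0 (trans (sym ([1+2j]%2≡1 j)) odd≡0)

count-shifted : ∀ j → count true (2 + 2 * j) ≡ count false (1 + 2 * j)
count-shifted j = begin
  count true (2 + 2 * j)
    ≡⟨ count-step true (2 * j) ⟩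
  (if does (fits? true odd odd) then count true odd else 0) +
  (if does (fits? true odd 0) then count false odd else 0)
    ≡⟨ cong₂ _+_ (if-no (fits? true odd odd) (m%2≢[1+m]%2 odd)) (if-yes (fits? true odd 0) ([1+2j]%2≡1 j)) ⟩
  count false odd
    ∎
  where
  open ≡-Reasoning
  odd : ℕ
  odd = 1 + 2 * j

count-odd-step : ∀ j → count false (3 + 2 * j) ≡ count false (2 + 2 * j) + count true (2 + 2 * j)
count-odd-step j = begin
  count false (3 + 2 * j)
    ≡⟨ count-step false (1 + 2 * j) ⟩
  (if does (fits? false even even) then count false even else 0) +
  (if does (fits? false even 0) then count true even else 0)
    ≡⟨ cong₂ _+_ (if-yes (fits? false even even) refl) (if-yes (fits? false even 0) ([2j]%2≡0 j)) ⟩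
  count false even + count true even
    ∎
  where
  open ≡-Reasoning
  even : ℕ
  even = 2 + 2 * j

count-odd : ∀ j → count false (1 + 2 * j) ≡ 2 ^ j
count-odd zero    = count-false-1
count-odd (suc j) = begin
  count false (1 + 2 * suc j)                       ≡⟨ cong (count false ∘ suc) (ℕ.*-suc 2 j) ⟩
  count false (3 + 2 * j)                           ≡⟨ count-odd-step j ⟩
  count false (2 + 2 * j) + count true (2 + 2 * j)  ≡⟨ cong₂ _+_ (count-even j) (count-shifted j) ⟩
  count false (1 + 2 * j) + count false (1 + 2 * j) ≡⟨ cong₂ _+_ (count-odd j) (count-odd j) ⟩
  2 ^ j + 2 ^ j                                     ≡⟨ cong (2 ^ j +_) (ℕ.+-identityʳ (2 ^ j)) ⟨
  2 ^ suc j                                         ∎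
  where open ≡-Reasoning

mainTheorem12 : (∀ (m : ℕ) → m ≥ 1 → pCount p231 p132 (2 * m) ≡ 2 ^ (m ∸ 1))
                × (∀ (m : ℕ) → pCount p231 p132 (2 * m + 1) ≡ 2 ^ m)
mainTheorem12 = even , odd
  where
  even : ∀ (m : ℕ) → m ≥ 1 → pCount p231 p132 (2 * m) ≡ 2 ^ (m ∸ 1)
  even (suc j) _ = begin
    pCount p231 p132 (2 * suc j)  ≡⟨ pCount≡count (2 * suc j) ⟩
    count false (2 * suc j)       ≡⟨ cong (count false) (ℕ.*-suc 2 j) ⟩
    count false (2 + 2 * j)       ≡⟨ count-even j ⟩
    count false (1 + 2 * j)       ≡⟨ count-odd j ⟩
    2 ^ j                         ∎
    where open ≡-Reasoning
  odd : ∀ (m : ℕ) → pCount p231 p132 (2 * m + 1) ≡ 2 ^ m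
  odd m = begin
    pCount p231 p132 (2 * m + 1)  ≡⟨ pCount≡count (2 * m + 1) ⟩
    count false (2 * m + 1)       ≡⟨ cong (count false) (ℕ.+-comm (2 * m) 1) ⟩
    count false (1 + 2 * m)       ≡⟨ count-odd m ⟩
    2 ^ m                         ∎
    where open ≡-Reasoning
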